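{- Suppose an instance admits an unsplit stable assignment, i.e. an unsplit assignment $x$ with $x(m)\le q(m)$ for every machine $m$ that is stable. Then the machine-optimal relaxed unsplit stable assignment $x_{\text{mopt}}$ of the instance is also an unsplit stable assignment, i.e. it additionally satisfies $x_{\text{mopt}}(m)\le q(m)$ for every machine $m$.
   Context: An instance consists of a finite bipartite graph $G=(J\cup M,E)$ between jobs $J$ and machines $M$; each job $j$ has size $q(j)>0$, each machine $m$ capacity $q(m)>0$; each job strictly ranks its adjacent machines and each machine strictly ranks its adjacent jobs. $M$ contains a dummy machine $m_d$ adjacent to every job, ranked last by every job, with $q(m_d)>\sum_{j\in J}q(j)$. An assignment is $x:E\to\mathbb{R}_{\ge0}$, $x(j)=\sum_m x(jm)$, $x(m)=\sum_j x(jm)$. It is unsplit if $x(jm)\in\{0,q(j)\}$ for all $jm$ and $x(j)\le q(j)$ for all $j$. An unsplit assignment $x$ is stable if for every edge $jm$ with $x(jm)=0$, either $j$ is assigned to a machine it prefers to $m$, or $\sum_{j':m\text{ prefers } j'\text{ to } j}x(j'm)\ge q(m)$. An unsplit $x$ is a relaxed unsplit assignment if for every machine $m$ with at least one assigned job, $x(m)-q(j_m)<q(m)$, where $j_m$ is the assigned job $m$ likes least. For unsplit $x_1,x_2$, machine $m$ weakly prefers $x_1$ to $x_2$ if either no edge incident to $m$ is positive in exactly one of $x_1,x_2$, or the edge $m$ ranks best among those incident edges positive in exactly one of them is positive in $x_1$. The machine-optimal relaxed unsplit stable assignment $x_{\text{mopt}}$ is the (existing) relaxed unsplit stable assignment that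 every machine weakly prefers to every relaxed unsplit stable assignment.
   Formalization: The job sizes $q(j)$, the machine capacities $q(m)$ and the values of assignments are rational rather than real. -}

module Defs where

open import Data.Nat using (ℕ; zero; suc; _<ᵇ_) renaming (_<_ to _<ℕ_; _≤_ to _≤ℕ_)
open import Data.Fin using (Fin; zero; suc)
open import Data.Bool using (Bool; T; if_then_else_; _∧_)
open import Data.Rational using (ℚ; 0ℚ; _+_; _-_; _≤_; _<_)
open import Data.Product using (_×_; ∃)
open import Data.Sum using (_⊎_)
open import Relation.Binary.PropositionalEquality using (_≡_; _≢_)
open import Relation.Nullary using (¬_)

sumFin : ∀ {n} → (Fin n → ℚ) → ℚ
sumFin {zero}  f = 0ℚ
sumFin {suc n} f = f zero + sumFin (λ i → f (suc i))

-- An instance: jobs Fin nJ, machines Fin nM, bipartite edges given by adj.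
-- Preferences are strict rankings given by ranks (smaller rank = more preferred),
-- injective on the adjacent vertices.
record Instance : Set where
  field
    nJ nM   : ℕ
    adj     : Fin nJ → Fin nM → Bool
    size    : Fin nJ → ℚ
    size-pos : ∀ j → 0ℚ < size j
    cap     : Fin nM → ℚ
    cap-pos : ∀ m → 0ℚ < cap m
    jrank   : Fin nJ → Fin nM → ℕ
    jrank-inj : ∀ j m m' → T (adj j m) → T (adj j m') → jrank j m ≡ jrank j m' → m ≡ m'
    mrank   : Fin nM → Fin nJ → ℕ
    mrank-inj : ∀ m j j' → T (adj j m) → T (adj j' m) → mrank m j ≡ mrank m j' → j ≡ j'
    md      : Fin nM
    md-adj  : ∀ j → T (adj j md)
    md-last : ∀ j m → T (adj j m) → m ≢ md → jrank j m <ℕ jrank j md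
    md-cap  : sumFin size < cap md

module _ (I : Instance) where
  open Instance I

  -- x(jm) for every pair; required to vanish on non-edges.
  Assignment : Set
  Assignment = Fin nJ → Fin nM → ℚ

  jobLoad : Assignment → Fin nJ → ℚ
  jobLoad x j = sumFin (λ m → x j m)

  machineLoad : Assignment → Fin nM → ℚ
  machineLoad x m = sumFin (λ j → x j m)

  IsUnsplit : Assignment → Set
  IsUnsplit x = (∀ j m → ¬ T (adj j m) → x j m ≡ 0ℚ)
              × (∀ j m → (x j m ≡ 0ℚ) ⊎ (x j m ≡ size j))
              × (∀ j → jobLoad x j ≤ size j)

  betterLoad : Assignment → Fin nM → Fin nJ → ℚ
  betterLoad x m j =
    sumFin (λ j' → if (adj j' m ∧ (mrank m j' <ᵇ mrank m j)) then x j' m else 0ℚ)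

  IsStable : Assignment → Set
  IsStable x = ∀ j m → T (adj j m) → x j m ≡ 0ℚ →
      (∃ λ m' → T (adj j m') × (0ℚ < x j m') × (jrank j m' <ℕ jrank j m))
    ⊎ (cap m ≤ betterLoad x m j)

  IsUnsplitStable : Assignment → Set
  IsUnsplitStable x = IsUnsplit x × (∀ m → machineLoad x m ≤ cap m) × IsStable x

  IsRelaxed : Assignment → Set
  IsRelaxed x = ∀ m j → 0ℚ < x j m →
    (∀ j' → 0ℚ < x j' m → mrank m j' ≤ℕ mrank m j) →
    machineLoad x m - size j < cap m

  IsRelaxedUnsplitStable : Assignment → Set
  IsRelaxedUnsplitStable x = IsUnsplit x × IsRelaxed x × IsStable x

  Differs : Assignment → Assignment → Fin nM → Fin nJ → Set
  Differs x1 x2 m j = T (adj j m) ×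
    (((0ℚ < x1 j m) × ¬ (0ℚ < x2 j m)) ⊎ (¬ (0ℚ < x1 j m) × (0ℚ < x2 j m)))

  WeaklyPrefers : Fin nM → Assignment → Assignment → Set
  WeaklyPrefers m x1 x2 = ∀ j → Differs x1 x2 m j →
    (∀ j' → Differs x1 x2 m j' → mrank m j ≤ℕ mrank m j') → 0ℚ < x1 j m

  IsMachineOptimalRelaxed : Assignment → Set
  IsMachineOptimalRelaxed x = IsRelaxedUnsplitStable x ×
    (∀ y → IsRelaxedUnsplitStable y → ∀ m → WeaklyPrefers m x y)

{-# OPTIONS --safe #-}
module Submission where

-- Let y be the machine-optimal relaxed unsplit stable assignment and x an unsplit stable one. As
-- x respects capacities it is relaxed, so every machine weakly prefers y to x. Call m attracting
-- if x puts on m a job j that prefers m to its machine in y; stability of y then fills m in y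
-- with jobs that m prefers to j, so x(m) ≤ q(m) ≤ y(m). A job k that y puts on an attracting
-- machine m cannot prefer m to its machine in x: stability of x would fill m in x with jobs m
-- prefers to k, contradicting the capacity of x if m prefers k to j and the relaxedness of y
-- otherwise. So every job that y puts on an attracting machine is put on one by x, and comparing
-- total sizes, conversely. At a machine m that is not attracting, the m-best edge on which x and
-- y differ is a y-edge by weak preference, and each way its job can rank its machine in x is
-- contradictory; so x and y coincide at m. Hence x(m) ≤ y(m) for every m, and as both assign
-- every job exactly once, the loads coincide and y respects the capacities.

open import Defs
open import Data.Product using (∃; _×_; _,_; proj₁; proj₂)

open import Data.Bool using (true; false; T; if_then_else_; _∧_)
open import Data.Bool.Properties using (T-∧)
open import Data.Empty using (⊥-elim)
open import Data.Fin using (Fin; zero; suc; punchIn)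
open import Data.Fin.Properties using (punchInᵢ≢i; _≟_; any?)
open import Data.List using (allFin; filter)
open import Data.List.Extrema.Nat using (argmin; argmax; argmin-all; argmax-all; f[argmin]≤f[xs]; f[xs]≤f[argmax])
open import Data.List.Membership.Propositional.Properties using (∈-filter⁺; ∈-allFin)
open import Data.List.Relation.Unary.All using (lookup)
open import Data.List.Relation.Unary.All.Properties using (all-filter)
open import Data.Nat using (ℕ; zero; suc; _<ᵇ_) renaming (_≤_ to _≤ℕ_; _<_ to _<ℕ_)
open import Data.Nat.Properties using (<ᵇ⇒<; <⇒<ᵇ)
import Data.Nat.Properties as ℕ
open import Data.Rational using (ℚ; 0ℚ; _+_; _-_; -_; _≤_; _<_)
open import Data.Rational.Properties hiding (_≟_)
open import Data.Sum using (_⊎_; inj₁; inj₂)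
open import Data.Unit using (⊤; tt)
open import Function using (_∘_; Equivalence)
open import Level using (0ℓ)
open import Relation.Binary.Definitions using (tri<; tri≈; tri>)
open import Relation.Binary.PropositionalEquality
open import Relation.Nullary using (¬_; yes; no)
open import Relation.Nullary.Decidable using (T?; _×-dec_; _⊎-dec_; ¬?; ⌊_⌋; toWitness; fromWitness)
open import Relation.Unary using (Pred; Decidable)

open import Algebra.Properties.Group +-0-group using (//-rightDividesʳ)
import Algebra.Properties.CommutativeMonoid.Sum +-0-commutativeMonoid as Σ

p<p+q : ∀ {p q} → 0ℚ < q → p < p + q
p<p+q {p} {q} 0<q = subst (_< p + q) (+-identityʳ p) (+-monoʳ-< p 0<q)

p≤q+p : ∀ {p q} → 0ℚ ≤ q → p ≤ q + p
p≤q+p {p} {q} 0≤q = subst (_≤ q + p) (+-identityˡ p) (+-monoˡ-≤ p 0≤q)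

p-q<p : ∀ {p q} → 0ℚ < q → p - q < p
p-q<p {p} {q} 0<q = subst (p - q <_) (+-identityʳ p) (+-monoʳ-< p (neg-antimono-< 0<q))

p+q≤r⇒p≤r-q : ∀ {p q r} → p + q ≤ r → p ≤ r - q
p+q≤r⇒p≤r-q {p} {q} {r} p+q≤r = subst (_≤ r - q) (//-rightDividesʳ q p) (+-monoˡ-≤ (- q) p+q≤r)

sumFin≡sum : ∀ {n} (f : Fin n → ℚ) → sumFin f ≡ Σ.sum f
sumFin≡sum {zero}  f = refl
sumFin≡sum {suc n} f = cong (f zero +_) (sumFin≡sum (f ∘ suc))

sumFin-cong : ∀ {n} {f g : Fin n → ℚ} → (∀ i → f i ≡ g i) → sumFin f ≡ sumFin g
sumFin-cong {f = f} {g} f≗g = begin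
  sumFin f  ≡⟨ sumFin≡sum f ⟩
  Σ.sum f   ≡⟨ Σ.sum-cong-≗ f≗g ⟩
  Σ.sum g   ≡⟨ sumFin≡sum g ⟨
  sumFin g  ∎
  where open ≡-Reasoning

sumFin-zero : ∀ {n} {f : Fin n → ℚ} → (∀ i → f i ≡ 0ℚ) → sumFin f ≡ 0ℚ
sumFin-zero {n} f≗0 = trans (sumFin-cong f≗0) (trans (sumFin≡sum {n} (λ _ → 0ℚ)) (Σ.sum-replicate-zero n))

sumFin-comm : ∀ {m n} (f : Fin m → Fin n → ℚ) →
              sumFin (λ i → sumFin (f i)) ≡ sumFin (λ j → sumFin (λ i → f i j))
sumFin-comm f = begin
  sumFin (λ i → sumFin (f i))          ≡⟨ sumFin≡sum (λ i → sumFin (f i)) ⟩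
  Σ.sum (λ i → sumFin (f i))           ≡⟨ Σ.sum-cong-≗ (λ i → sumFin≡sum (f i)) ⟩
  Σ.sum (λ i → Σ.sum (f i))            ≡⟨ Σ.∑-comm f ⟩
  Σ.sum (λ j → Σ.sum (λ i → f i j))    ≡⟨ Σ.sum-cong-≗ (λ j → sumFin≡sum (λ i → f i j)) ⟨
  Σ.sum (λ j → sumFin (λ i → f i j))   ≡⟨ sumFin≡sum (λ j → sumFin (λ i → f i j)) ⟨
  sumFin (λ j → sumFin (λ i → f i j))  ∎
  where open ≡-Reasoning

sumFin-single : ∀ {n} {f : Fin n → ℚ} a → (∀ i → i ≢ a → f i ≡ 0ℚ) → sumFin f ≡ f a
sumFin-single {suc n} {f} a f≡0 = begin
  sumFin f                                ≡⟨ sumFin≡sum f ⟩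
  Σ.sum f                                 ≡⟨ Σ.sum-remove f ⟩
  f a + Σ.sum (f ∘ punchIn a)             ≡⟨ cong (f a +_) (sumFin≡sum (f ∘ punchIn a)) ⟨
  f a + sumFin (f ∘ punchIn a)            ≡⟨ cong (f a +_) (sumFin-zero (λ i → f≡0 _ (punchInᵢ≢i a i))) ⟩
  f a + 0ℚ                                ≡⟨ +-identityʳ (f a) ⟩
  f a                                     ∎
  where open ≡-Reasoning

sumFin-mono-≤ : ∀ {n} {f g : Fin n → ℚ} → (∀ i → f i ≤ g i) → sumFin f ≤ sumFin g
sumFin-mono-≤ {zero}  f≤g = ≤-refl
sumFin-mono-≤ {suc n} f≤g = +-mono-≤ (f≤g zero) (sumFin-mono-≤ (f≤g ∘ suc))

sumFin-insert : ∀ {n} {f g : Fin n → ℚ} → (∀ i → g i ≤ f i) →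
                ∀ a → g a ≡ 0ℚ → sumFin g + f a ≤ sumFin f
sumFin-insert {suc n} {f} {g} g≤f zero g₀≡0 = begin
  (g zero + sumFin (g ∘ suc)) + f zero  ≡⟨ cong (λ t → (t + sumFin (g ∘ suc)) + f zero) g₀≡0 ⟩
  (0ℚ + sumFin (g ∘ suc)) + f zero      ≡⟨ cong (_+ f zero) (+-identityˡ (sumFin (g ∘ suc))) ⟩
  sumFin (g ∘ suc) + f zero             ≡⟨ +-comm (sumFin (g ∘ suc)) (f zero) ⟩
  f zero + sumFin (g ∘ suc)             ≤⟨ +-monoʳ-≤ (f zero) (sumFin-mono-≤ (g≤f ∘ suc)) ⟩
  f zero + sumFin (f ∘ suc)             ∎
  where open ≤-Reasoning
sumFin-insert {suc n} {f} {g} g≤f (suc a) gₐ≡0 = begin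
  (g zero + sumFin (g ∘ suc)) + f (suc a)  ≡⟨ +-assoc (g zero) (sumFin (g ∘ suc)) (f (suc a)) ⟩
  g zero + (sumFin (g ∘ suc) + f (suc a))  ≤⟨ +-mono-≤ (g≤f zero) (sumFin-insert (g≤f ∘ suc) a gₐ≡0) ⟩
  f zero + sumFin (f ∘ suc)                ∎
  where open ≤-Reasoning

term≤sumFin : ∀ {n} {f : Fin n → ℚ} → (∀ i → 0ℚ ≤ f i) → ∀ a → f a ≤ sumFin f
term≤sumFin {n} {f} 0≤f a = subst (_≤ sumFin f) 0+fa≡fa (sumFin-insert 0≤f a refl)
  where
  0+fa≡fa : sumFin {n} (λ _ → 0ℚ) + f a ≡ f a
  0+fa≡fa = trans (cong (_+ f a) (sumFin-zero {n} (λ _ → refl))) (+-identityˡ (f a))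

two-terms≤sumFin : ∀ {n} {f : Fin n → ℚ} → (∀ i → 0ℚ ≤ f i) →
                   ∀ {a b} → a ≢ b → f a + f b ≤ sumFin f
two-terms≤sumFin 0≤f {zero}  {zero}  a≢b = ⊥-elim (a≢b refl)
two-terms≤sumFin {f = f} 0≤f {zero}  {suc b} _ =
  +-monoʳ-≤ (f zero) (term≤sumFin (0≤f ∘ suc) b)
two-terms≤sumFin {f = f} 0≤f {suc a} {zero}  _ =
  subst (_≤ sumFin f) (+-comm (f zero) (f (suc a))) (+-monoʳ-≤ (f zero) (term≤sumFin (0≤f ∘ suc) a))
two-terms≤sumFin 0≤f {suc a} {suc b} sa≢sb =
  ≤-trans (two-terms≤sumFin (0≤f ∘ suc) (sa≢sb ∘ cong suc)) (p≤q+p (0≤f zero))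

sumFin-squeeze : ∀ {n} {f g : Fin n → ℚ} → (∀ i → f i ≤ g i) → sumFin g ≤ sumFin f →
                 ∀ i → f i ≡ g i
sumFin-squeeze {suc n} {f} {g} f≤g ∑g≤∑f i
  with g zero ≤? f zero | sumFin (g ∘ suc) ≤? sumFin (f ∘ suc)
... | no g₀≰f₀ | _ =
  ⊥-elim (<-irrefl refl (≤-<-trans ∑g≤∑f (+-mono-<-≤ (≰⇒> g₀≰f₀) (sumFin-mono-≤ (f≤g ∘ suc)))))
... | yes _ | no ∑g≰∑f =
  ⊥-elim (<-irrefl refl (≤-<-trans ∑g≤∑f (+-mono-≤-< (f≤g zero) (≰⇒> ∑g≰∑f))))
sumFin-squeeze f≤g _ zero    | yes g₀≤f₀ | yes _ = ≤-antisym (f≤g zero) g₀≤f₀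
sumFin-squeeze f≤g _ (suc i) | yes _ | yes ∑g≤∑f = sumFin-squeeze (f≤g ∘ suc) ∑g≤∑f i

module _ {n : ℕ} {P : Pred (Fin n) 0ℓ} (P? : Decidable P) (r : Fin n → ℕ) where

  private
    xs = filter P? (allFin n)

  ∃-minimal-rank : ∀ {i} → P i → ∃ λ k → P k × (∀ j → P j → r k ≤ℕ r j)
  ∃-minimal-rank {i} Pi =
    argmin r i xs , argmin-all r Pi (all-filter P? (allFin n)) ,
    λ j Pj → lookup (f[argmin]≤f[xs] i xs) (∈-filter⁺ P? (∈-allFin j) Pj)

  ∃-maximal-rank : ∀ {i} → P i → ∃ λ k → P k × (∀ j → P j → r j ≤ℕ r k)
  ∃-maximal-rank {i} Pi =
    argmax r i xs , argmax-all r Pi (all-filter P? (allFin n)) ,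
    λ j Pj → lookup (f[xs]≤f[argmax] i xs) (∈-filter⁺ P? (∈-allFin j) Pj)

module _ {q : ℚ} where

  if-≤ : ∀ b → 0ℚ ≤ q → (if b then q else 0ℚ) ≤ q
  if-≤ true  _   = ≤-refl
  if-≤ false 0≤q = 0≤q

  if-cond-mono-≤ : ∀ {b c} → (T b → T c) → 0ℚ ≤ q → (if b then q else 0ℚ) ≤ (if c then q else 0ℚ)
  if-cond-mono-≤ {true}  {true}  _   _   = ≤-refl
  if-cond-mono-≤ {true}  {false} b⇒c _   = ⊥-elim (b⇒c tt)
  if-cond-mono-≤ {false} {true}  _   0≤q = 0≤q
  if-cond-mono-≤ {false} {false} _   _   = ≤-refl

  if-cond-cancel-≤ : ∀ {b c} → 0ℚ < q → (if c then q else 0ℚ) ≤ (if b then q else 0ℚ) → T c → T b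
  if-cond-cancel-≤ {true}          _   _   _  = tt
  if-cond-cancel-≤ {false} {true}  0<q q≤0 _  = ⊥-elim (<-irrefl refl (<-≤-trans 0<q q≤0))
  if-cond-cancel-≤ {false} {false} _   _   ()

  if-zero : ∀ b → (T b → q ≡ 0ℚ) → (if b then q else 0ℚ) ≡ 0ℚ
  if-zero true  q≡0 = q≡0 tt
  if-zero false _   = refl

if-cong : ∀ b {p q} → (T b → p ≡ q) → (if b then p else 0ℚ) ≡ (if b then q else 0ℚ)
if-cong true  p≡q = p≡q tt
if-cong false _   = refl

if-mono-≤ : ∀ b {p q} → (T b → p ≤ q) → (if b then p else 0ℚ) ≤ (if b then q else 0ℚ)
if-mono-≤ true  p≤q = p≤q tt
if-mono-≤ false _   = ≤-refl

if-sumFin : ∀ b {n} (f : Fin n → ℚ) → (if b then sumFin f else 0ℚ) ≡ sumFin (λ i → if b then f i else 0ℚ)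
if-sumFin true  f = refl
if-sumFin false {n} f = sym (sumFin-zero {n} (λ _ → refl))

T-∧-<ᵇ⁻ : ∀ {b m n} → T (b ∧ (m <ᵇ n)) → T b × m <ℕ n
T-∧-<ᵇ⁻ {b} {m} {n} t with Equivalence.to T-∧ t
... | tb , m<ᵇn = tb , <ᵇ⇒< m n m<ᵇn

T-∧-<ᵇ⁺ : ∀ {b m n} → T b → m <ℕ n → T (b ∧ (m <ᵇ n))
T-∧-<ᵇ⁺ tb m<n = Equivalence.from T-∧ (tb , <⇒<ᵇ m<n)

module _ {I : Instance} where
  open Instance I

  capacity⇒relaxed : ∀ {z : Assignment I} → (∀ m → machineLoad I z m ≤ cap m) → IsRelaxed I z
  capacity⇒relaxed load≤cap m j _ _ = <-≤-trans (p-q<p (size-pos j)) (load≤cap m)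

  module Unsplit {z : Assignment I} (z-unsplit : IsUnsplit I z) where

    ≡0-off-edges : ∀ j m → ¬ T (adj j m) → z j m ≡ 0ℚ
    ≡0-off-edges = proj₁ z-unsplit

    ≡0-or-size : ∀ j m → z j m ≡ 0ℚ ⊎ z j m ≡ size j
    ≡0-or-size = proj₁ (proj₂ z-unsplit)

    jobLoad≤size : ∀ j → jobLoad I z j ≤ size j
    jobLoad≤size = proj₂ (proj₂ z-unsplit)

    nonneg : ∀ j m → 0ℚ ≤ z j m
    nonneg j m with ≡0-or-size j m
    ... | inj₁ z≡0    = ≤-reflexive (sym z≡0)
    ... | inj₂ z≡size = subst (0ℚ ≤_) (sym z≡size) (<⇒≤ (size-pos j))

    ≤size : ∀ j m → z j m ≤ size j
    ≤size j m with ≡0-or-size j m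
    ... | inj₁ z≡0    = subst (_≤ size j) (sym z≡0) (<⇒≤ (size-pos j))
    ... | inj₂ z≡size = ≤-reflexive z≡size

    pos⇒≡size : ∀ {j m} → 0ℚ < z j m → z j m ≡ size j
    pos⇒≡size {j} {m} pos with ≡0-or-size j m
    ... | inj₁ z≡0    = ⊥-elim (<-irrefl (sym z≡0) pos)
    ... | inj₂ z≡size = z≡size

    ≯0⇒≡0 : ∀ {j m} → ¬ (0ℚ < z j m) → z j m ≡ 0ℚ
    ≯0⇒≡0 {j} {m} ¬pos with ≡0-or-size j m
    ... | inj₁ z≡0    = z≡0
    ... | inj₂ z≡size = ⊥-elim (¬pos (subst (0ℚ <_) (sym z≡size) (size-pos j)))

    pos⇒adj : ∀ {j m} → 0ℚ < z j m → T (adj j m)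
    pos⇒adj {j} {m} pos with T? (adj j m)
    ... | yes adj-jm = adj-jm
    ... | no ¬adj-jm = ⊥-elim (<-irrefl (sym (≡0-off-edges j m ¬adj-jm)) pos)

    pos-unique : ∀ {j a b} → 0ℚ < z j a → 0ℚ < z j b → a ≡ b
    pos-unique {j} {a} {b} pos-a pos-b with a ≟ b
    ... | yes a≡b = a≡b
    ... | no  a≢b = ⊥-elim (<-irrefl refl (begin-strict
      size j             <⟨ p<p+q (size-pos j) ⟩
      size j + size j    ≡⟨ cong₂ _+_ (pos⇒≡size pos-a) (pos⇒≡size pos-b) ⟨
      z j a + z j b      ≤⟨ two-terms≤sumFin (nonneg j) a≢b ⟩
      jobLoad I z j      ≤⟨ jobLoad≤size j ⟩
      size j             ∎))
      where open ≤-Reasoning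

    betterLoad≤machineLoad : ∀ m j → betterLoad I z m j ≤ machineLoad I z m
    betterLoad≤machineLoad m j = sumFin-mono-≤ (λ j' → if-≤ _ (nonneg j' m))

    betterLoad-mono : ∀ m {j₁ j₂} → mrank m j₁ ≤ℕ mrank m j₂ →
                      betterLoad I z m j₁ ≤ betterLoad I z m j₂
    betterLoad-mono m r₁≤r₂ = sumFin-mono-≤ λ j' → if-cond-mono-≤
      (λ t → let adj-j'm , r'<r₁ = T-∧-<ᵇ⁻ t in T-∧-<ᵇ⁺ adj-j'm (ℕ.<-≤-trans r'<r₁ r₁≤r₂))
      (nonneg j' m)

    betterLoad+≤machineLoad : ∀ m {j w} → mrank m j ≤ℕ mrank m w →
                              betterLoad I z m j + z w m ≤ machineLoad I z m
    betterLoad+≤machineLoad m {j} {w} r≤rw = sumFin-insert (λ j' → if-≤ _ (nonneg j' m)) w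
      (if-zero (adj w m ∧ (mrank m w <ᵇ mrank m j)) (λ t → ⊥-elim (ℕ.<⇒≱ (proj₂ (T-∧-<ᵇ⁻ t)) r≤rw)))

    relaxed⇒betterLoad<cap : IsRelaxed I z → ∀ {j m} → 0ℚ < z j m → betterLoad I z m j < cap m
    relaxed⇒betterLoad<cap z-relaxed {j} {m} pos
      with ∃-maximal-rank (λ j' → 0ℚ <? z j' m) (mrank m) pos
    ... | w , w-pos , w-last = ≤-<-trans (p+q≤r⇒p≤r-q better+w≤load) (z-relaxed m w w-pos w-last)
      where
      better+w≤load : betterLoad I z m j + size w ≤ machineLoad I z m
      better+w≤load = subst (λ t → betterLoad I z m j + t ≤ machineLoad I z m) (pos⇒≡size w-pos)
                            (betterLoad+≤machineLoad m (w-last j pos))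

  module Stable {z : Assignment I} (z-unsplit : IsUnsplit I z) (z-stable : IsStable I z) where
    open Unsplit z-unsplit public

    assigned : ∀ j → ∃ λ m → 0ℚ < z j m
    assigned j with 0ℚ <? z j md
    ... | yes pos = md , pos
    ... | no ¬pos with z-stable j md (md-adj j) (≯0⇒≡0 ¬pos)
    ...   | inj₁ (m , _ , pos , _) = m , pos
    ...   | inj₂ md-full = ⊥-elim (<-irrefl refl (begin-strict
      cap md                  ≤⟨ md-full ⟩
      betterLoad I z md j     ≤⟨ betterLoad≤machineLoad md j ⟩
      machineLoad I z md      ≤⟨ sumFin-mono-≤ (λ j' → ≤size j' md) ⟩
      sumFin size             <⟨ md-cap ⟩
      cap md                  ∎))
      where open ≤-Reasoning

    σ : Fin nJ → Fin nM
    σ j = proj₁ (assigned j)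

    σ-pos : ∀ j → 0ℚ < z j (σ j)
    σ-pos j = proj₂ (assigned j)

    σ-unique : ∀ {j m} → 0ℚ < z j m → m ≡ σ j
    σ-unique {j} pos = pos-unique pos (σ-pos j)

    ≡0-off-σ : ∀ {j m} → m ≢ σ j → z j m ≡ 0ℚ
    ≡0-off-σ m≢σj = ≯0⇒≡0 (m≢σj ∘ σ-unique)

    blocked : ∀ {j m} → T (adj j m) → jrank j m <ℕ jrank j (σ j) → cap m ≤ betterLoad I z m j
    blocked {j} {m} adj-jm m-better
      with z-stable j m adj-jm (≡0-off-σ (λ m≡σj → ℕ.<-irrefl (cong (jrank j) m≡σj) m-better))
    ... | inj₁ (m' , _ , pos , m'-better) =
      ⊥-elim (ℕ.<-asym (subst (λ t → jrank j t <ℕ jrank j m) (σ-unique pos) m'-better) m-better)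
    ... | inj₂ m-full = m-full

    ∑-restricted-load : ∀ {A : Pred (Fin nM) 0ℓ} (A? : Decidable A) →
      sumFin (λ m → if ⌊ A? m ⌋ then machineLoad I z m else 0ℚ) ≡
      sumFin (λ j → if ⌊ A? (σ j) ⌋ then size j else 0ℚ)
    ∑-restricted-load A? = begin
      sumFin (λ m → if ⌊ A? m ⌋ then sumFin (λ j → z j m) else 0ℚ)
        ≡⟨ sumFin-cong (λ m → if-sumFin (⌊ A? m ⌋) (λ j → z j m)) ⟩
      sumFin (λ m → sumFin (λ j → if ⌊ A? m ⌋ then z j m else 0ℚ))
        ≡⟨ sumFin-comm (λ m j → if ⌊ A? m ⌋ then z j m else 0ℚ) ⟩
      sumFin (λ j → sumFin (λ m → if ⌊ A? m ⌋ then z j m else 0ℚ))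
        ≡⟨ sumFin-cong (λ j → sumFin-single (σ j) (λ m m≢σj → if-zero (⌊ A? m ⌋) (λ _ → ≡0-off-σ m≢σj))) ⟩
      sumFin (λ j → if ⌊ A? (σ j) ⌋ then z j (σ j) else 0ℚ)
        ≡⟨ sumFin-cong (λ j → if-cong (⌊ A? (σ j) ⌋) (λ _ → pos⇒≡size (σ-pos j))) ⟩
      sumFin (λ j → if ⌊ A? (σ j) ⌋ then size j else 0ℚ)
        ∎
      where open ≡-Reasoning

    ∑machineLoad≡∑size : sumFin (machineLoad I z) ≡ sumFin size
    ∑machineLoad≡∑size = ∑-restricted-load {A = λ _ → ⊤} (λ _ → yes tt)

  module Comparison
    {x y : Assignment I}
    (x-unsplit : IsUnsplit I x) (x-within-cap : ∀ m → machineLoad I x m ≤ cap m) (x-stable : IsStable I x)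
    (y-unsplit : IsUnsplit I y) (y-relaxed : IsRelaxed I y) (y-stable : IsStable I y)
    (y-preferred : ∀ m → WeaklyPrefers I m y x)
    where

    module X = Stable x-unsplit x-stable
    module Y = Stable y-unsplit y-stable

    Attracts : Pred (Fin nM) 0ℓ
    Attracts m = ∃ λ j → 0ℚ < x j m × jrank j m <ℕ jrank j (Y.σ j)

    attracts? : Decidable Attracts
    attracts? m = any? λ j → (0ℚ <? x j m) ×-dec (jrank j m ℕ.<? jrank j (Y.σ j))

    x-load≤y-load-on-Attracts : ∀ {m} → Attracts m → machineLoad I x m ≤ machineLoad I y m
    x-load≤y-load-on-Attracts {m} (j , x-pos , m-better) = begin
      machineLoad I x m   ≤⟨ x-within-cap m ⟩
      cap m               ≤⟨ Y.blocked (X.pos⇒adj x-pos) m-better ⟩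
      betterLoad I y m j  ≤⟨ Y.betterLoad≤machineLoad m j ⟩
      machineLoad I y m   ∎
      where open ≤-Reasoning

    x-full⇒¬Attracts : ∀ {k m} → 0ℚ < y k m → cap m ≤ betterLoad I x m k → ¬ Attracts m
    x-full⇒¬Attracts {k} {m} y-pos x-full (j , x-pos , m-better) with ℕ.≤-total (mrank m j) (mrank m k)
    ... | inj₁ j-above = <-irrefl refl (begin-strict
      cap m               ≤⟨ Y.blocked (X.pos⇒adj x-pos) m-better ⟩
      betterLoad I y m j  ≤⟨ Y.betterLoad-mono m j-above ⟩
      betterLoad I y m k  <⟨ Y.relaxed⇒betterLoad<cap y-relaxed y-pos ⟩
      cap m               ∎)
      where open ≤-Reasoning
    ... | inj₂ k-above = <-irrefl refl (begin-strict
      betterLoad I x m k            <⟨ p<p+q x-pos ⟩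
      betterLoad I x m k + x j m    ≤⟨ X.betterLoad+≤machineLoad m k-above ⟩
      machineLoad I x m             ≤⟨ x-within-cap m ⟩
      cap m                         ≤⟨ x-full ⟩
      betterLoad I x m k            ∎)
      where open ≤-Reasoning

    compare-at-y-edge : ∀ {j m} → 0ℚ < y j m →
      jrank j (X.σ j) <ℕ jrank j m ⊎ 0ℚ < x j m ⊎ cap m ≤ betterLoad I x m j
    compare-at-y-edge {j} {m} y-pos with ℕ.<-cmp (jrank j (X.σ j)) (jrank j m)
    ... | tri< x-better _ _ = inj₁ x-better
    ... | tri≈ _ same _     = inj₂ (inj₁ (subst (λ t → 0ℚ < x j t) σx≡m (X.σ-pos j)))
      where
      σx≡m : X.σ j ≡ m
      σx≡m = jrank-inj j (X.σ j) m (X.pos⇒adj (X.σ-pos j)) (Y.pos⇒adj y-pos) same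
    ... | tri> _ _ y-better = inj₂ (inj₂ (X.blocked (Y.pos⇒adj y-pos) y-better))

    Attracts-σy⇒Attracts-σx : ∀ j → Attracts (Y.σ j) → Attracts (X.σ j)
    Attracts-σy⇒Attracts-σx j attracts with compare-at-y-edge (Y.σ-pos j)
    ... | inj₁ x-better           = j , X.σ-pos j , x-better
    ... | inj₂ (inj₁ x-pos)       = subst Attracts (X.σ-unique x-pos) attracts
    ... | inj₂ (inj₂ x-full)      = ⊥-elim (x-full⇒¬Attracts (Y.σ-pos j) x-full attracts)

    attractedSize : (Fin nJ → Fin nM) → Fin nJ → ℚ
    attractedSize σ j = if ⌊ attracts? (σ j) ⌋ then size j else 0ℚ

    ∑attractedSize-x≤y : sumFin (attractedSize X.σ) ≤ sumFin (attractedSize Y.σ)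
    ∑attractedSize-x≤y = begin
      sumFin (attractedSize X.σ)
        ≡⟨ X.∑-restricted-load attracts? ⟨
      sumFin (λ m → if ⌊ attracts? m ⌋ then machineLoad I x m else 0ℚ)
        ≤⟨ sumFin-mono-≤ (λ m → if-mono-≤ ⌊ attracts? m ⌋ (x-load≤y-load-on-Attracts ∘ toWitness)) ⟩
      sumFin (λ m → if ⌊ attracts? m ⌋ then machineLoad I y m else 0ℚ)
        ≡⟨ Y.∑-restricted-load attracts? ⟩
      sumFin (attractedSize Y.σ)
        ∎
      where open ≤-Reasoning

    attractedSize-y≤x : ∀ j → attractedSize Y.σ j ≤ attractedSize X.σ j
    attractedSize-y≤x j =
      if-cond-mono-≤ (fromWitness ∘ Attracts-σy⇒Attracts-σx j ∘ toWitness) (<⇒≤ (size-pos j))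

    attractedSize-y≡x : ∀ j → attractedSize Y.σ j ≡ attractedSize X.σ j
    attractedSize-y≡x = sumFin-squeeze attractedSize-y≤x ∑attractedSize-x≤y

    Attracts-σx⇒Attracts-σy : ∀ j → Attracts (X.σ j) → Attracts (Y.σ j)
    Attracts-σx⇒Attracts-σy j attracts = toWitness
      (if-cond-cancel-≤ (size-pos j) (≤-reflexive (sym (attractedSize-y≡x j))) (fromWitness attracts))

    y-edge-x-better⇒Attracts : ∀ {j m} → 0ℚ < y j m → jrank j (X.σ j) <ℕ jrank j m → Attracts m
    y-edge-x-better⇒Attracts {j} {m} y-pos x-better =
      subst Attracts (sym m≡σy) (Attracts-σx⇒Attracts-σy j (j , X.σ-pos j , σx-better))
      where
      m≡σy : m ≡ Y.σ j
      m≡σy = Y.σ-unique y-pos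
      σx-better : jrank j (X.σ j) <ℕ jrank j (Y.σ j)
      σx-better = subst (λ t → jrank j (X.σ j) <ℕ jrank j t) m≡σy x-better

    differs? : ∀ m → Decidable (Differs I y x m)
    differs? m j = T? (adj j m) ×-dec
      (((0ℚ <? y j m) ×-dec ¬? (0ℚ <? x j m)) ⊎-dec (¬? (0ℚ <? y j m) ×-dec (0ℚ <? x j m)))

    ¬Differs⇒≡ : ∀ {m j} → ¬ Differs I y x m j → x j m ≡ y j m
    ¬Differs⇒≡ {m} {j} agree with T? (adj j m) | 0ℚ <? y j m | 0ℚ <? x j m
    ... | no ¬adj    | _         | _         = trans (X.≡0-off-edges j m ¬adj) (sym (Y.≡0-off-edges j m ¬adj))
    ... | yes _      | yes y-pos | yes x-pos = trans (X.pos⇒≡size x-pos) (sym (Y.pos⇒≡size y-pos))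
    ... | yes adj-jm | yes y-pos | no ¬x-pos = ⊥-elim (agree (adj-jm , inj₁ (y-pos , ¬x-pos)))
    ... | yes adj-jm | no ¬y-pos | yes x-pos = ⊥-elim (agree (adj-jm , inj₂ (¬y-pos , x-pos)))
    ... | yes _      | no ¬y-pos | no ¬x-pos = trans (X.≯0⇒≡0 ¬x-pos) (sym (Y.≯0⇒≡0 ¬y-pos))

    betterLoad-agree : ∀ {m js} → (∀ j → Differs I y x m j → mrank m js ≤ℕ mrank m j) →
                       betterLoad I x m js ≡ betterLoad I y m js
    betterLoad-agree {m} {js} first = sumFin-cong λ j → if-cong (adj j m ∧ (mrank m j <ᵇ mrank m js))
      λ t → ¬Differs⇒≡ (λ d → ℕ.<⇒≱ (proj₂ (T-∧-<ᵇ⁻ t)) (first j d))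

    ¬Attracts⇒¬Differs : ∀ {m} → ¬ Attracts m → ∀ {j} → ¬ Differs I y x m j
    ¬Attracts⇒¬Differs {m} ¬attracts d with ∃-minimal-rank (differs? m) (mrank m) d
    ... | js , js-differs@(_ , inj₂ (¬y-pos , _)) , first = ¬y-pos (y-preferred m js js-differs first)
    ... | js , (_ , inj₁ (y-pos , ¬x-pos)) , first with compare-at-y-edge y-pos
    ...   | inj₁ x-better      = ¬attracts (y-edge-x-better⇒Attracts y-pos x-better)
    ...   | inj₂ (inj₁ x-pos)  = ¬x-pos x-pos
    ...   | inj₂ (inj₂ x-full) = <-irrefl refl (begin-strict
      cap m                ≤⟨ x-full ⟩
      betterLoad I x m js  ≡⟨ betterLoad-agree first ⟩
      betterLoad I y m js  <⟨ Y.relaxed⇒betterLoad<cap y-relaxed y-pos ⟩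
      cap m                ∎)
      where open ≤-Reasoning

    x-load≤y-load : ∀ m → machineLoad I x m ≤ machineLoad I y m
    x-load≤y-load m with attracts? m
    ... | yes attracts = x-load≤y-load-on-Attracts attracts
    ... | no ¬attracts = ≤-reflexive (sumFin-cong λ j → ¬Differs⇒≡ (¬Attracts⇒¬Differs ¬attracts {j}))

    y-within-cap : ∀ m → machineLoad I y m ≤ cap m
    y-within-cap m = subst (_≤ cap m) (sumFin-squeeze x-load≤y-load ∑y≤∑x m) (x-within-cap m)
      where
      ∑y≤∑x : sumFin (machineLoad I y) ≤ sumFin (machineLoad I x)
      ∑y≤∑x = ≤-reflexive (trans Y.∑machineLoad≡∑size (sym X.∑machineLoad≡∑size))

lemma1 : (I : Instance) (xmopt : Assignment I) →
    IsMachineOptimalRelaxed I xmopt →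
    (∃ λ x → IsUnsplitStable I x) →
    IsUnsplitStable I xmopt
lemma1 I y ((y-unsplit , y-relaxed , y-stable) , y-optimal) (x , x-unsplit , x-within-cap , x-stable) =
  y-unsplit , Comparison.y-within-cap {I} x-unsplit x-within-cap x-stable y-unsplit y-relaxed y-stable y-preferred , y-stable
  where
  y-preferred : ∀ m → WeaklyPrefers I m y x
  y-preferred = y-optimal x (x-unsplit , capacity⇒relaxed {I} x-within-cap , x-stable)
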